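{- For all $n\ge 3$, if $\phi$ is a coloring of $E(K_n)$ using exactly two colors from $\{\text{red},\text{green},\text{blue}\}$ that is special (i.e. vertex-special or edge-special), then $w(\phi)=3\cdot 2^{n-1}+1$.
   Context: A Gallai coloring of $K_m$ is a coloring $E(K_m)\to\{\text{red},\text{green},\text{blue}\}$ with no rainbow triangle (triangle whose three edges have three distinct colors); every coloring with at most two colors is Gallai. For a Gallai coloring $\psi$ of $K_m$, regard $K_{m+1}$ as $K_m$ plus a new vertex $u$; $w(\psi)$ is the number of colorings of the edges from $u$ to $V(K_m)$ with colors in $\{\text{red},\text{green},\text{blue}\}$ such that the resulting coloring of $E(K_{m+1})$ is Gallai. A vertex is monochromatic (of color $c$) if all edges incident to it have color $c$. A coloring of $E(K_n)$ using exactly two colors is vertex-special if there is a vertex $v$ monochromatic in a color $c_1$ and all edges not incident to $v$ have a single color $c_2\ne c_1$; it is edge-special if all edges have the same color except for exactly one edge. -}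

module Defs where

open import Data.Nat using (ℕ; zero; suc)
open import Data.Fin using (Fin; zero; suc)
open import Data.Fin.Properties using (all?)
open import Data.List using (List; []; _∷_; map; concatMap; filter; length)
open import Data.Product using (_×_; _,_; ∃; ∃-syntax)
open import Relation.Nullary using (¬_; Dec; yes; no)
open import Relation.Nullary.Decidable using (¬?; _×-dec_; _→-dec_)
open import Relation.Binary.PropositionalEquality using (_≡_; _≢_; refl)

data Colour : Set where
  red green blue : Colour

_≟c_ : (a b : Colour) → Dec (a ≡ b)
red   ≟c red   = yes refl
red   ≟c green = no λ ()
red   ≟c blue  = no λ ()
green ≟c red   = no λ ()
green ≟c green = yes refl
green ≟c blue  = no λ ()
blue  ≟c red   = no λ ()
blue  ≟c green = no λ ()
blue  ≟c blue  = yes refl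

_≟f_ : ∀ {n} (i j : Fin n) → Dec (i ≡ j)
_≟f_ = Data.Fin._≟_

-- A colouring of E(K_n): a function on ordered pairs of vertices; only the
-- values c i j with i ≢ j are meaningful (diagonal values are ignored).
-- Colourings of E(K_n) are the symmetric such functions.
Colouring : ℕ → Set
Colouring n = Fin n → Fin n → Colour

Symmetric : ∀ {n} → Colouring n → Set
Symmetric {n} c = (i j : Fin n) → c i j ≡ c j i

Rainbow : Colour → Colour → Colour → Set
Rainbow a b d = (a ≢ b) × (b ≢ d) × (a ≢ d)

Gallai : ∀ {n} → Colouring n → Set
Gallai {n} c = (i j k : Fin n) → i ≢ j → j ≢ k → i ≢ k →
  ¬ Rainbow (c i j) (c j k) (c i k)

gallai? : ∀ {n} (c : Colouring n) → Dec (Gallai c)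
gallai? c = all? λ i → all? λ j → all? λ k →
  ¬? (i ≟f j) →-dec (¬? (j ≟f k) →-dec (¬? (i ≟f k) →-dec
    ¬? (¬? (c i j ≟c c j k) ×-dec (¬? (c j k ≟c c i k) ×-dec ¬? (c i j ≟c c i k)))))

-- K_{m+1} = K_m plus a new vertex u, here u = zero and old vertex i is suc i;
-- f colours the edges from u to V(K_m).
extend : ∀ {m} → Colouring m → (Fin m → Colour) → Colouring (suc m)
extend c f zero    zero    = red   -- diagonal, irrelevant
extend c f zero    (suc j) = f j
extend c f (suc i) zero    = f i
extend c f (suc i) (suc j) = c i j

allColours : List Colour
allColours = red ∷ green ∷ blue ∷ []

cons : ∀ {m} → Colour → (Fin m → Colour) → (Fin (suc m) → Colour)
cons a f zero    = a
cons a f (suc j) = f j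

allFns : (m : ℕ) → List (Fin m → Colour)
allFns zero    = (λ ()) ∷ []
allFns (suc m) = concatMap (λ a → map (cons a) (allFns m)) allColours

w : ∀ {m} → Colouring m → ℕ
w {m} c = length (filter (λ f → gallai? (extend c f)) (allFns m))

ExactlyTwoColours : ∀ {n} → Colouring n → Set
ExactlyTwoColours {n} c = ∃[ a ] ∃[ b ] (a ≢ b ×
  ((i j : Fin n) → i ≢ j → (c i j ≡ a ⊎' c i j ≡ b)) ×
  (∃[ i ] ∃[ j ] (i ≢ j × c i j ≡ a)) ×
  (∃[ i ] ∃[ j ] (i ≢ j × c i j ≡ b)))
  where open import Data.Sum renaming (_⊎_ to _⊎'_)

VertexSpecial : ∀ {n} → Colouring n → Set
VertexSpecial {n} c = ∃[ v ] ∃[ c₁ ] ∃[ c₂ ] (c₁ ≢ c₂ ×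
  ((j : Fin n) → j ≢ v → c v j ≡ c₁) ×
  ((i j : Fin n) → i ≢ j → i ≢ v → j ≢ v → c i j ≡ c₂))

EdgeSpecial : ∀ {n} → Colouring n → Set
EdgeSpecial {n} c = ∃[ i₀ ] ∃[ j₀ ] ∃[ a ] (i₀ ≢ j₀ × c i₀ j₀ ≢ a ×
  ((i j : Fin n) → i ≢ j → ¬ ((i ≡ i₀ × j ≡ j₀) ⊎' (i ≡ j₀ × j ≡ i₀)) → c i j ≡ a))
  where open import Data.Sum renaming (_⊎_ to _⊎'_)

module Submission where

-- A special colouring uses only two colours, so every rainbow triangle of the extension
-- contains the new vertex: f, the colouring of the new edges, is admissible iff no edge ij has
-- (f i, φ i j, f j) rainbow. The admissible f then split into five disjoint classes, each a
-- product set of colourings (one of them minus a single colouring). With n vertices: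
--   v monochromatic in c₁, the rest c₂, c₃ unused:  f v = c₁ and the others in {c₁,c₂} (2^(n-1))
--   or in {c₂,c₃} but not all c₂ (2^(n-1) - 1);  f v = c₂ and the others avoid c₃ (2^(n-1));
--   f v = c₃ and the others all c₁ or all c₃ (1 + 1).
--   pq coloured b, the rest a, c unused:  f avoids c (2^n);  f p = f q = a, the others avoid b
--   and f is not constantly a (2^(n-2) - 1);  f p = f q = c, the others avoid b (2^(n-2));
--   (f p, f q) is (b, c) or (c, b) and the others are a (1 + 1).

open import Data.Empty using (⊥-elim)
open import Data.Fin using (Fin; zero; suc; punchIn; punchOut)
open import Data.Fin.Properties using (all?; any?; suc-injective; punchInᵢ≢i; punchIn-injective; punchIn-punchOut)
open import Data.List using (List; []; _∷_; map; filter; length; _++_; concatMap)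
open import Data.List.Properties using (filter-++; length-++; filter-≐; filter-accept; filter-reject; filter-none; filter-all)
open import Data.List.Relation.Unary.All using (universal)
open import Data.Nat using (ℕ; zero; suc; _+_; _*_; _^_; _∸_; _≥_; s≤s)
open import Data.Nat.Properties using (*-1-commutativeMonoid; +-suc; +-comm; *-identityˡ; ^-zeroˡ)
open import Data.Nat.Tactic.RingSolver using (solve)
open import Algebra.Properties.CommutativeMonoid.Sum *-1-commutativeMonoid using (sum-remove) renaming (sum to ∏)
open import Data.Product using (_×_; _,_; proj₁; proj₂)
open import Data.Sum as Sum using (_⊎_; inj₁; inj₂)
open import Function using (_∘_; id)
open import Level using (0ℓ)
open import Relation.Nullary using (¬_; Dec; yes; no)
open import Relation.Nullary.Decidable using (_×-dec_; _⊎-dec_; _→-dec_; ¬?)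
open import Relation.Unary using (Pred; Decidable; _⊆_; _≐_; _∪_; _∩_; ∁; _⊥_)
open import Relation.Unary.Properties using (_∪?_; _∩?_; ∁?; ≐-trans)
open import Relation.Binary.PropositionalEquality

open import Defs

variable
  T : Set
  n m : ℕ

-- Colours and rainbow triples

-- Junk value red when a ≡ b.
third : Colour → Colour → Colour
third red   green = blue
third green red   = blue
third red   blue  = green
third blue  red   = green
third green blue  = red
third blue  green = red
third _     _     = red

rainbow-third : ∀ {a b} → a ≢ b → Rainbow a b (third a b)
rainbow-third {red}   {red}   a≢b = ⊥-elim (a≢b refl)
rainbow-third {green} {green} a≢b = ⊥-elim (a≢b refl)
rainbow-third {blue}  {blue}  a≢b = ⊥-elim (a≢b refl)
rainbow-third {red}   {green} _   = (λ ()) , (λ ()) , (λ ())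
rainbow-third {red}   {blue}  _   = (λ ()) , (λ ()) , (λ ())
rainbow-third {green} {red}   _   = (λ ()) , (λ ()) , (λ ())
rainbow-third {green} {blue}  _   = (λ ()) , (λ ()) , (λ ())
rainbow-third {blue}  {red}   _   = (λ ()) , (λ ()) , (λ ())
rainbow-third {blue}  {green} _   = (λ ()) , (λ ()) , (λ ())

colour-cases : ∀ {a b} → a ≢ b → ∀ x → x ≡ a ⊎ x ≡ b ⊎ x ≡ third a b
colour-cases {red}   {red}   a≢b _ = ⊥-elim (a≢b refl)
colour-cases {green} {green} a≢b _ = ⊥-elim (a≢b refl)
colour-cases {blue}  {blue}  a≢b _ = ⊥-elim (a≢b refl)
colour-cases {red}   {green} _ red   = inj₁ refl
colour-cases {red}   {green} _ green = inj₂ (inj₁ refl)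
colour-cases {red}   {green} _ blue  = inj₂ (inj₂ refl)
colour-cases {red}   {blue}  _ red   = inj₁ refl
colour-cases {red}   {blue}  _ green = inj₂ (inj₂ refl)
colour-cases {red}   {blue}  _ blue  = inj₂ (inj₁ refl)
colour-cases {green} {red}   _ red   = inj₂ (inj₁ refl)
colour-cases {green} {red}   _ green = inj₁ refl
colour-cases {green} {red}   _ blue  = inj₂ (inj₂ refl)
colour-cases {green} {blue}  _ red   = inj₂ (inj₂ refl)
colour-cases {green} {blue}  _ green = inj₁ refl
colour-cases {green} {blue}  _ blue  = inj₂ (inj₁ refl)
colour-cases {blue}  {red}   _ red   = inj₂ (inj₁ refl)
colour-cases {blue}  {red}   _ green = inj₂ (inj₂ refl)
colour-cases {blue}  {red}   _ blue  = inj₁ refl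
colour-cases {blue}  {green} _ red   = inj₂ (inj₂ refl)
colour-cases {blue}  {green} _ green = inj₂ (inj₁ refl)
colour-cases {blue}  {green} _ blue  = inj₁ refl

rainbow-exhaustive : ∀ {a b c} → Rainbow a b c → ∀ x → x ≡ a ⊎ x ≡ b ⊎ x ≡ c
rainbow-exhaustive {a} {b} {c} (a≢b , b≢c , a≢c) x with colour-cases a≢b c | colour-cases a≢b x
... | inj₁ c≡a        | _ = ⊥-elim (a≢c (sym c≡a))
... | inj₂ (inj₁ c≡b) | _ = ⊥-elim (b≢c (sym c≡b))
... | inj₂ (inj₂ c≡t) | x-cases = Sum.map₂ (Sum.map₂ (λ x≡t → trans x≡t (sym c≡t))) x-cases

rainbow-last : ∀ {a b c x} → Rainbow a b c → x ≢ a → x ≢ b → x ≡ c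
rainbow-last rb x≢a x≢b with rainbow-exhaustive rb _
... | inj₁ x≡a        = ⊥-elim (x≢a x≡a)
... | inj₂ (inj₁ x≡b) = ⊥-elim (x≢b x≡b)
... | inj₂ (inj₂ x≡c) = x≡c

≡⇒≢ : ∀ {a b : Colour} → a ≢ b → (_≡ a) ⊆ (_≢ b)
≡⇒≢ a≢b refl = a≢b

module _ {x e y : Colour} where

  ¬rainbowˡ : x ≡ e → ¬ Rainbow x e y
  ¬rainbowˡ x≡e (x≢e , _) = x≢e x≡e

  ¬rainbowʳ : y ≡ e → ¬ Rainbow x e y
  ¬rainbowʳ y≡e (_ , e≢y , _) = e≢y (sym y≡e)

  ¬rainbow-ends : x ≡ y → ¬ Rainbow x e y
  ¬rainbow-ends x≡y (_ , _ , x≢y) = x≢y x≡y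

  rainbow-swap : Rainbow x e y → Rainbow y e x
  rainbow-swap (x≢e , e≢y , x≢y) = ≢-sym e≢y , ≢-sym x≢e , ≢-sym x≢y

  rainbow-swapʳ : Rainbow x e y → Rainbow x y e
  rainbow-swapʳ (x≢e , e≢y , x≢y) = x≢y , ≢-sym e≢y , x≢e

  rainbow-rotate : Rainbow x e y → Rainbow y x e
  rainbow-rotate (x≢e , e≢y , x≢y) = ≢-sym x≢y , x≢e , ≢-sym e≢y

  ¬rainbow-cong : ∀ {e′} → e ≡ e′ → ¬ Rainbow x e y → ¬ Rainbow x e′ y
  ¬rainbow-cong refl ¬rb = ¬rb

  ¬rainbow⇒≡ : ¬ Rainbow x e y → x ≢ e → y ≢ e → x ≡ y
  ¬rainbow⇒≡ ¬rb x≢e y≢e with x ≟c y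
  ... | yes x≡y = x≡y
  ... | no x≢y  = ⊥-elim (¬rb (x≢e , ≢-sym y≢e , x≢y))

  missing⇒¬rainbow : ∀ {t} → x ≢ t → e ≢ t → y ≢ t → ¬ Rainbow x e y
  missing⇒¬rainbow {t} x≢t e≢t y≢t rb with rainbow-exhaustive rb t
  ... | inj₁ t≡x        = x≢t (sym t≡x)
  ... | inj₂ (inj₁ t≡e) = e≢t (sym t≡e)
  ... | inj₂ (inj₂ t≡y) = y≢t (sym t≡y)

¬rainbow-twice⇒≡ : ∀ {x e y z} → ¬ Rainbow x e y → ¬ Rainbow x e z → y ≢ e → z ≢ e → y ≢ z → x ≡ e
¬rainbow-twice⇒≡ {x} {e} ¬rb₁ ¬rb₂ y≢e z≢e y≢z with x ≟c e
... | yes x≡e = x≡e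
... | no x≢e  = ⊥-elim (y≢z (trans (sym (¬rainbow⇒≡ ¬rb₁ x≢e y≢e)) (¬rainbow⇒≡ ¬rb₂ x≢e z≢e)))

-- Counting

count : {P : Pred T 0ℓ} → Decidable P → List T → ℕ
count P? xs = length (filter P? xs)

module _ {P : Pred T 0ℓ} (P? : Decidable P) where

  count-none : (∀ x → ¬ P x) → ∀ xs → count P? xs ≡ 0
  count-none ¬P xs = cong length (filter-none P? (universal ¬P xs))

  count-++ : ∀ xs ys → count P? (xs ++ ys) ≡ count P? xs + count P? ys
  count-++ xs ys = trans (cong length (filter-++ P? xs ys)) (length-++ (filter P? xs))

  count-map : ∀ {S : Set} (g : S → T) xs → count P? (map g xs) ≡ count (P? ∘ g) xs
  count-map g [] = refl
  count-map g (x ∷ xs) with P? (g x)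
  ... | yes _ = cong suc (count-map g xs)
  ... | no _ = count-map g xs

module _ {P Q : Pred T 0ℓ} (P? : Decidable P) (Q? : Decidable Q) where

  count-cong : P ≐ Q → ∀ xs → count P? xs ≡ count Q? xs
  count-cong P≐Q xs = cong length (filter-≐ P? Q? P≐Q xs)

  count-⊎ : P ⊥ Q → ∀ xs → count (P? ∪? Q?) xs ≡ count P? xs + count Q? xs
  count-⊎ P⊥Q [] = refl
  count-⊎ P⊥Q (x ∷ xs) with P? x | Q? x
  ... | yes px | yes qx = ⊥-elim (P⊥Q (px , qx))
  ... | yes _  | no _   = cong suc (count-⊎ P⊥Q xs)
  ... | no _   | yes _  = trans (cong suc (count-⊎ P⊥Q xs)) (sym (+-suc _ _))
  ... | no _   | no _   = count-⊎ P⊥Q xs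

count-⊆ : {P Q : Pred T 0ℓ} (P? : Decidable P) (Q? : Decidable Q) → Q ⊆ P →
  ∀ xs → count P? xs ≡ count (P? ∩? ∁? Q?) xs + count Q? xs
count-⊆ {P = P} {Q} P? Q? Q⊆P xs = trans (count-cong P? ((P? ∩? ∁? Q?) ∪? Q?) P≐ xs)
  (count-⊎ (P? ∩? ∁? Q?) Q? (λ ((_ , ¬q) , q) → ¬q q) xs)
  where
  split : ∀ {x} → Dec (Q x) → P x → ((P ∩ ∁ Q) ∪ Q) x
  split (yes qx) _  = inj₂ qx
  split (no ¬qx) px = inj₁ (px , ¬qx)
  P≐ : P ≐ (P ∩ ∁ Q) ∪ Q
  P≐ = (λ {x} → split (Q? x)) , λ { (inj₁ (px , _)) → px ; (inj₂ qx) → Q⊆P qx }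

ColourSet : Set₁
ColourSet = Pred Colour 0ℓ

size : {C : ColourSet} → Decidable C → ℕ
size C? = count C? allColours

size-≡ : ∀ c → size (_≟c c) ≡ 1
size-≡ red   = refl
size-≡ green = refl
size-≡ blue  = refl

size-≢ : ∀ c → size (∁? (_≟c c)) ≡ 2
size-≢ red   = refl
size-≢ green = refl
size-≢ blue  = refl

Box : (Fin n → ColourSet) → Pred (Fin n → Colour) 0ℓ
Box S f = ∀ i → S i (f i)

box? : {S : Fin n → ColourSet} → (∀ i → Decidable (S i)) → Decidable (Box S)
box? S? f = all? λ i → S? i (f i)

count-box-cons : {S : Fin (suc n) → ColourSet} (S? : ∀ i → Decidable (S i)) (fs : List (Fin n → Colour)) →
  ∀ cs → count (box? S?) (concatMap (λ c → map (cons c) fs) cs) ≡ count (S? zero) cs * count (box? (S? ∘ suc)) fs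
count-box-cons S? fs [] = refl
count-box-cons {n} {S = S} S? fs (c ∷ cs) = begin
  count (box? S?) (map (cons c) fs ++ rest)
    ≡⟨ count-++ (box? S?) (map (cons c) fs) rest ⟩
  count (box? S?) (map (cons c) fs) + count (box? S?) rest
    ≡⟨ cong₂ _+_ (count-map (box? S?) (cons c) fs) (count-box-cons S? fs cs) ⟩
  count (box? S? ∘ cons c) fs + count (S? zero) cs * N
    ≡⟨ head-case (S? zero c) ⟩
  count (S? zero) (c ∷ cs) * N ∎
  where
  open ≡-Reasoning
  rest : List (Fin (suc n) → Colour)
  rest = concatMap (λ c → map (cons c) fs) cs
  N : ℕ
  N = count (box? (S? ∘ suc)) fs
  tail≐ : S zero c → (Box S ∘ cons c) ≐ Box (S ∘ suc)
  tail≐ s = (λ b → b ∘ suc) , λ b → λ { zero → s ; (suc i) → b i }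
  head-case : Dec (S zero c) → count (box? S? ∘ cons c) fs + count (S? zero) cs * N ≡ count (S? zero) (c ∷ cs) * N
  head-case (yes s) = trans
    (cong (_+ count (S? zero) cs * N) (count-cong (box? S? ∘ cons c) (box? (S? ∘ suc)) (tail≐ s) fs))
    (cong (_* N) (sym (cong length (filter-accept (S? zero) s))))
  head-case (no ¬s) = trans
    (cong (_+ count (S? zero) cs * N) (count-none (box? S? ∘ cons c) (λ _ b → ¬s (b zero)) fs))
    (cong (_* N) (sym (cong length (filter-reject (S? zero) ¬s))))

count-box : {S : Fin n → ColourSet} (S? : ∀ i → Decidable (S i)) →
  count (box? S?) (allFns n) ≡ ∏ (λ i → size (S? i))
count-box {zero}  S? = cong length (filter-all (box? S?) (universal (λ _ ()) (allFns 0)))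
count-box {suc n} S? = trans (count-box-cons S? (allFns n) allColours)
                             (cong (size (S? zero) *_) (count-box (S? ∘ suc)))

∏-const : ∀ {g : Fin n → ℕ} {k} → (∀ i → g i ≡ k) → ∏ g ≡ k ^ n
∏-const {zero}  g≡k = refl
∏-const {suc n} g≡k = cong₂ _*_ (g≡k zero) (∏-const (g≡k ∘ suc))

∏-pointed : ∀ {g : Fin (suc n) → ℕ} {k} v → (∀ i → i ≢ v → g i ≡ k) → ∏ g ≡ g v * k ^ n
∏-pointed {g = g} v g≡k = trans (sum-remove {i = v} g) (cong (g v *_) (∏-const λ j → g≡k _ (punchInᵢ≢i v j)))

∏-twoPointed : ∀ {g : Fin (suc (suc n)) → ℕ} {k} {p q} → p ≢ q →
  (∀ i → i ≢ p → i ≢ q → g i ≡ k) → ∏ g ≡ g p * (g q * k ^ n)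
∏-twoPointed {n} {g = g} {k} {p} {q} p≢q g≡k = begin
  ∏ g                                ≡⟨ sum-remove {i = p} g ⟩
  g p * ∏ (g ∘ punchIn p)            ≡⟨ cong (g p *_) (∏-pointed q′ away) ⟩
  g p * (g (punchIn p q′) * k ^ n)   ≡⟨ cong (λ i → g p * (g i * k ^ n)) (punchIn-punchOut p≢q) ⟩
  g p * (g q * k ^ n)                ∎
  where
  open ≡-Reasoning
  q′ : Fin (suc n)
  q′ = punchOut p≢q
  away : ∀ j → j ≢ q′ → g (punchIn p j) ≡ k
  away j j≢q′ = g≡k _ (punchInᵢ≢i p j) λ eq →
    j≢q′ (punchIn-injective p j q′ (trans eq (sym (punchIn-punchOut p≢q))))

OnePoint : Fin n → ColourSet → ColourSet → Pred (Fin n → Colour) 0ℓ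
OnePoint v A K f = A (f v) × (∀ i → i ≢ v → K (f i))

onePoint? : ∀ (v : Fin n) {A K} → Decidable A → Decidable K → Decidable (OnePoint v A K)
onePoint? v A? K? f = A? (f v) ×-dec all? λ i → ¬? (i ≟f v) →-dec K? (f i)

TwoPoint : Fin n → Fin n → ColourSet → ColourSet → ColourSet → Pred (Fin n → Colour) 0ℓ
TwoPoint p q A B K f = A (f p) × B (f q) × (∀ i → i ≢ p → i ≢ q → K (f i))

twoPoint? : ∀ (p q : Fin n) {A B K} → Decidable A → Decidable B → Decidable K → Decidable (TwoPoint p q A B K)
twoPoint? p q A? B? K? f =
  A? (f p) ×-dec (B? (f q) ×-dec all? λ i → ¬? (i ≟f p) →-dec (¬? (i ≟f q) →-dec K? (f i)))

count-onePoint : ∀ (v : Fin (suc n)) {A K} (A? : Decidable A) (K? : Decidable K) →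
  count (onePoint? v A? K?) (allFns (suc n)) ≡ size A? * size K? ^ n
count-onePoint {n} v {A} {K} A? K? = begin
  count (onePoint? v A? K?) (allFns (suc n))
    ≡⟨ count-cong (onePoint? v A? K?) (box? S?) as-box (allFns (suc n)) ⟩
  count (box? S?) (allFns (suc n))
    ≡⟨ count-box S? ⟩
  ∏ (λ i → size (S? i))
    ≡⟨ ∏-pointed v (λ i i≢v → count-cong (S? i) K? (at-K i≢v) allColours) ⟩
  size (S? v) * size K? ^ n
    ≡⟨ cong (_* size K? ^ n) (count-cong (S? v) A? at-A allColours) ⟩
  size A? * size K? ^ n ∎
  where
  open ≡-Reasoning
  S : Fin (suc n) → ColourSet
  S i x = (i ≡ v → A x) × (i ≢ v → K x)
  S? : ∀ i → Decidable (S i)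
  S? i x = ((i ≟f v) →-dec A? x) ×-dec (¬? (i ≟f v) →-dec K? x)
  as-box : OnePoint v A K ≐ Box S
  as-box = (λ (a , k) i → (λ { refl → a }) , k i) , λ b → proj₁ (b v) refl , λ i → proj₂ (b i)
  at-A : S v ≐ A
  at-A = (λ s → proj₁ s refl) , λ a → (λ _ → a) , λ v≢v → ⊥-elim (v≢v refl)
  at-K : ∀ {i} → i ≢ v → S i ≐ K
  at-K i≢v = (λ s → proj₂ s i≢v) , λ k → (λ i≡v → ⊥-elim (i≢v i≡v)) , λ _ → k

count-twoPoint : ∀ {p q : Fin (suc (suc n))} {A B K} → p ≢ q →
  (A? : Decidable A) (B? : Decidable B) (K? : Decidable K) →
  count (twoPoint? p q A? B? K?) (allFns (suc (suc n))) ≡ size A? * (size B? * size K? ^ n)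
count-twoPoint {n} {p} {q} {A} {B} {K} p≢q A? B? K? = begin
  count (twoPoint? p q A? B? K?) (allFns (suc (suc n)))
    ≡⟨ count-cong (twoPoint? p q A? B? K?) (box? S?) as-box (allFns (suc (suc n))) ⟩
  count (box? S?) (allFns (suc (suc n)))
    ≡⟨ count-box S? ⟩
  ∏ (λ i → size (S? i))
    ≡⟨ ∏-twoPointed p≢q (λ i i≢p i≢q → count-cong (S? i) K? (at-K i≢p i≢q) allColours) ⟩
  size (S? p) * (size (S? q) * size K? ^ n)
    ≡⟨ cong₂ (λ α β → α * (β * size K? ^ n)) (count-cong (S? p) A? at-A allColours)
                                              (count-cong (S? q) B? at-B allColours) ⟩
  size A? * (size B? * size K? ^ n) ∎
  where
  open ≡-Reasoning
  S : Fin (suc (suc n)) → ColourSet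
  S i x = (i ≡ p → A x) × (i ≡ q → B x) × (i ≢ p → i ≢ q → K x)
  S? : ∀ i → Decidable (S i)
  S? i x = ((i ≟f p) →-dec A? x)
    ×-dec (((i ≟f q) →-dec B? x) ×-dec (¬? (i ≟f p) →-dec (¬? (i ≟f q) →-dec K? x)))
  as-box : TwoPoint p q A B K ≐ Box S
  as-box = (λ (a , b , k) i → (λ { refl → a }) , (λ { refl → b }) , k i)
         , λ s → proj₁ (s p) refl , proj₁ (proj₂ (s q)) refl , λ i → proj₂ (proj₂ (s i))
  at-A : S p ≐ A
  at-A = (λ s → proj₁ s refl)
       , λ a → (λ _ → a) , (λ p≡q → ⊥-elim (p≢q p≡q)) , λ p≢p → ⊥-elim (p≢p refl)
  at-B : S q ≐ B
  at-B = (λ s → proj₁ (proj₂ s) refl)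
       , λ b → (λ q≡p → ⊥-elim (p≢q (sym q≡p))) , (λ _ → b) , λ _ q≢q → ⊥-elim (q≢q refl)
  at-K : ∀ {i} → i ≢ p → i ≢ q → S i ≐ K
  at-K i≢p i≢q = (λ s → proj₂ (proj₂ s) i≢p i≢q)
               , λ k → (λ i≡p → ⊥-elim (i≢p i≡p)) , (λ i≡q → ⊥-elim (i≢q i≡q)) , λ _ _ → k

count-uniform : ∀ n {K} (K? : Decidable K) → count (box? {n} λ _ → K?) (allFns n) ≡ size K? ^ n
count-uniform n K? = trans (count-box {n} (λ _ → K?)) (∏-const {n} λ _ → refl)


module _ (v : Fin (suc n)) (x y : Colour) where

  count-onePoint-≢ : count (onePoint? v (_≟c x) (∁? (_≟c y))) (allFns (suc n)) ≡ 2 ^ n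
  count-onePoint-≢ = trans (count-onePoint v (_≟c x) (∁? (_≟c y)))
    (trans (cong₂ (λ s k → s * k ^ n) (size-≡ x) (size-≢ y)) (*-identityˡ _))

  count-onePoint-≡ : count (onePoint? v (_≟c x) (_≟c y)) (allFns (suc n)) ≡ 1
  count-onePoint-≡ = trans (count-onePoint v (_≟c x) (_≟c y))
    (trans (cong₂ (λ s k → s * k ^ n) (size-≡ x) (size-≡ y)) (trans (*-identityˡ _) (^-zeroˡ n)))

module _ {p q : Fin (2 + n)} (p≢q : p ≢ q) (x y z : Colour) where

  count-twoPoint-≢ : count (twoPoint? p q (_≟c x) (_≟c y) (∁? (_≟c z))) (allFns (2 + n)) ≡ 2 ^ n
  count-twoPoint-≢ = trans (count-twoPoint p≢q (_≟c x) (_≟c y) (∁? (_≟c z)))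
    (trans (cong₂ _*_ (size-≡ x) (cong₂ (λ t k → t * k ^ n) (size-≡ y) (size-≢ z)))
           (trans (*-identityˡ _) (*-identityˡ _)))

  count-twoPoint-≡ : count (twoPoint? p q (_≟c x) (_≟c y) (_≟c z)) (allFns (2 + n)) ≡ 1
  count-twoPoint-≡ = trans (count-twoPoint p≢q (_≟c x) (_≟c y) (_≟c z))
    (trans (cong₂ _*_ (size-≡ x) (cong₂ (λ t k → t * k ^ n) (size-≡ y) (size-≡ z)))
           (trans (*-identityˡ _) (trans (*-identityˡ _) (^-zeroˡ n))))

twoPoint⇒box : ∀ {p q : Fin n} {A B K K′ : ColourSet} → A ⊆ K′ → B ⊆ K′ → K ⊆ K′ →
  ∀ {f} → TwoPoint p q A B K f → ∀ i → K′ (f i)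
twoPoint⇒box {p = p} {q} A⊆K′ B⊆K′ K⊆K′ (fp , fq , rest) i with i ≟f p | i ≟f q
... | yes refl | _        = A⊆K′ fp
... | no _     | yes refl = B⊆K′ fq
... | no i≢p   | no i≢q   = K⊆K′ (rest i i≢p i≢q)

one-side-empty : ∀ {P Q : Pred (Fin n) 0ℓ} → Decidable Q → (∀ i j → P i → ¬ Q j) →
  (∀ i → ¬ P i) ⊎ (∀ j → ¬ Q j)
one-side-empty Q? no-pair with any? Q?
... | yes (j , qj) = inj₁ λ i pi → no-pair i j pi qj
... | no ¬∃q       = inj₂ λ j qj → ¬∃q (j , qj)

class-sizes : ∀ s {t} y → y + 1 ≡ t → s + (y + (t + (1 + 1))) ≡ s + 2 * t + 1
class-sizes s y refl = solve (s ∷ y ∷ [])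

-- Admissible extensions

Admissible : Colouring n → Pred (Fin n → Colour) 0ℓ
Admissible φ f = ∀ i j → i ≢ j → ¬ Rainbow (f i) (φ i j) (f j)

missing⇒gallai : ∀ {φ : Colouring n} {t} → (∀ i j → i ≢ j → φ i j ≢ t) → Gallai φ
missing⇒gallai miss i j k i≢j j≢k i≢k = missing⇒¬rainbow (miss i j i≢j) (miss j k j≢k) (miss i k i≢k)

module _ {φ : Colouring n} where

  gallai-extend⇒admissible : ∀ {f} → Gallai (extend φ f) → Admissible φ f
  gallai-extend⇒admissible gallai i j i≢j = gallai zero (suc i) (suc j) (λ ()) (i≢j ∘ suc-injective) (λ ())

  admissible⇒gallai-extend : Gallai φ → ∀ {f} → Admissible φ f → Gallai (extend φ f)
  admissible⇒gallai-extend _ adm zero    zero    _       0≢0 _   _   = ⊥-elim (0≢0 refl)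
  admissible⇒gallai-extend _ adm zero    (suc j) zero    _   _   0≢0 = ⊥-elim (0≢0 refl)
  admissible⇒gallai-extend _ adm zero    (suc j) (suc k) _   j≢k _   = adm j k (j≢k ∘ cong suc)
  admissible⇒gallai-extend _ adm (suc i) zero    zero    _   0≢0 _   = ⊥-elim (0≢0 refl)
  admissible⇒gallai-extend _ adm (suc i) zero    (suc k) _   _   i≢k = adm i k (i≢k ∘ cong suc) ∘ rainbow-swapʳ
  admissible⇒gallai-extend _ adm (suc i) (suc j) zero    i≢j _   _   = adm i j (i≢j ∘ cong suc) ∘ rainbow-rotate
  admissible⇒gallai-extend gallai _ (suc i) (suc j) (suc k) i≢j j≢k i≢k =
    gallai i j k (i≢j ∘ cong suc) (j≢k ∘ cong suc) (i≢k ∘ cong suc)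

  w-via-admissible : Gallai φ → ∀ {P} (P? : Decidable P) → Admissible φ ≐ P → w φ ≡ count P? (allFns n)
  w-via-admissible gallai P? admissible≐P = count-cong (λ f → gallai? (extend φ f)) P?
    (proj₁ admissible≐P ∘ gallai-extend⇒admissible , admissible⇒gallai-extend gallai ∘ proj₂ admissible≐P)
    (allFns n)

module VertexSpecialCount {m} (φ : Colouring (2 + m)) (φ-sym : Symmetric φ) (v : Fin (2 + m))
  {c₁ c₂ : Colour} (c₁≢c₂ : c₁ ≢ c₂)
  (at-v : ∀ j → j ≢ v → φ v j ≡ c₁)
  (off-v : ∀ i j → i ≢ j → i ≢ v → j ≢ v → φ i j ≡ c₂) where

  c₃ : Colour
  c₃ = third c₁ c₂

  c₂≢c₃ : c₂ ≢ c₃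
  c₂≢c₃ = proj₁ (proj₂ (rainbow-third c₁≢c₂))

  c₁≢c₃ : c₁ ≢ c₃
  c₁≢c₃ = proj₂ (proj₂ (rainbow-third c₁≢c₂))

  φ-cases : ∀ i j → i ≢ j →
    (i ≡ v × φ i j ≡ c₁) ⊎ (j ≡ v × φ i j ≡ c₁) ⊎ (i ≢ v × j ≢ v × φ i j ≡ c₂)
  φ-cases i j i≢j with i ≟f v | j ≟f v
  ... | yes refl | _        = inj₁ (refl , at-v j (≢-sym i≢j))
  ... | no i≢v   | yes refl = inj₂ (inj₁ (refl , trans (φ-sym i v) (at-v i i≢v)))
  ... | no i≢v   | no j≢v   = inj₂ (inj₂ (i≢v , j≢v , off-v i j i≢j i≢v j≢v))

  φ-gallai : Gallai φ
  φ-gallai = missing⇒gallai φ≢c₃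
    where
    φ≢c₃ : ∀ i j → i ≢ j → φ i j ≢ c₃
    φ≢c₃ i j i≢j with φ-cases i j i≢j
    ... | inj₁ (_ , φ≡c₁)            = ≡⇒≢ c₁≢c₃ φ≡c₁
    ... | inj₂ (inj₁ (_ , φ≡c₁))     = ≡⇒≢ c₁≢c₃ φ≡c₁
    ... | inj₂ (inj₂ (_ , _ , φ≡c₂)) = ≡⇒≢ c₂≢c₃ φ≡c₂

  Spokes Rim : Pred (Fin (2 + m) → Colour) 0ℓ
  Spokes f = ∀ i → i ≢ v → ¬ Rainbow (f v) c₁ (f i)
  Rim f = ∀ i j → i ≢ v → j ≢ v → ¬ Rainbow (f i) c₂ (f j)

  admissible≐spokes∩rim : Admissible φ ≐ Spokes ∩ Rim
  admissible≐spokes∩rim = to , from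
    where
    to : Admissible φ ⊆ Spokes ∩ Rim
    to {f} adm = (λ i i≢v → ¬rainbow-cong (at-v i i≢v) (adm v i (≢-sym i≢v)))
               , λ i j i≢v j≢v → rim i j i≢v j≢v (i ≟f j)
      where
      rim : ∀ i j → i ≢ v → j ≢ v → Dec (i ≡ j) → ¬ Rainbow (f i) c₂ (f j)
      rim i j _ _ (yes i≡j)    = ¬rainbow-ends (cong f i≡j)
      rim i j i≢v j≢v (no i≢j) = ¬rainbow-cong (off-v i j i≢j i≢v j≢v) (adm i j i≢j)
    from : Spokes ∩ Rim ⊆ Admissible φ
    from (spokes , rim) i j i≢j with φ-cases i j i≢j
    ... | inj₁ (refl , φ≡c₁)              = ¬rainbow-cong (sym φ≡c₁) (spokes j (≢-sym i≢j))
    ... | inj₂ (inj₁ (refl , φ≡c₁))       = ¬rainbow-cong (sym φ≡c₁) (spokes i i≢j ∘ rainbow-swap)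
    ... | inj₂ (inj₂ (i≢v , j≢v , φ≡c₂)) = ¬rainbow-cong (sym φ≡c₂) (rim i j i≢v j≢v)

  Y₁ B C Y₂ Y₃ Y₄ Y₅ : Pred (Fin (2 + m) → Colour) 0ℓ
  Y₁ = OnePoint v (_≡ c₁) (_≢ c₃)
  B  = OnePoint v (_≡ c₁) (_≢ c₁)
  C  = OnePoint v (_≡ c₁) (_≡ c₂)
  Y₂ = B ∩ ∁ C
  Y₃ = OnePoint v (_≡ c₂) (_≢ c₃)
  Y₄ = OnePoint v (_≡ c₃) (_≡ c₁)
  Y₅ = OnePoint v (_≡ c₃) (_≡ c₃)

  Y₁? : Decidable Y₁
  Y₁? = onePoint? v (_≟c c₁) (∁? (_≟c c₃))
  B? : Decidable B
  B? = onePoint? v (_≟c c₁) (∁? (_≟c c₁))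
  C? : Decidable C
  C? = onePoint? v (_≟c c₁) (_≟c c₂)
  Y₂? : Decidable Y₂
  Y₂? = B? ∩? ∁? C?
  Y₃? : Decidable Y₃
  Y₃? = onePoint? v (_≟c c₂) (∁? (_≟c c₃))
  Y₄? : Decidable Y₄
  Y₄? = onePoint? v (_≟c c₃) (_≟c c₁)
  Y₅? : Decidable Y₅
  Y₅? = onePoint? v (_≟c c₃) (_≟c c₃)

  Classes : Pred (Fin (2 + m) → Colour) 0ℓ
  Classes = Y₁ ∪ (Y₂ ∪ (Y₃ ∪ (Y₄ ∪ Y₅)))

  Classes? : Decidable Classes
  Classes? = Y₁? ∪? (Y₂? ∪? (Y₃? ∪? (Y₄? ∪? Y₅?)))

  module _ {f : Fin (2 + m) → Colour} where

    rim-excludes : Rim f → ∀ {i j x y} → i ≢ v → j ≢ v → f i ≡ x → f j ≡ y → ¬ Rainbow x c₂ y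
    rim-excludes rim i≢v j≢v refl refl = rim _ _ i≢v j≢v

    spokes-exclude : Spokes f → ∀ {i x y} → i ≢ v → f v ≡ x → f i ≡ y → ¬ Rainbow x c₁ y
    spokes-exclude spokes i≢v refl refl = spokes _ i≢v

    Coloured : Colour → Pred (Fin (2 + m)) 0ℓ
    Coloured x i = i ≢ v × f i ≡ x

    rim-separates : Rim f → ∀ {x y} → Rainbow x c₂ y → (∀ i → ¬ Coloured x i) ⊎ (∀ j → ¬ Coloured y j)
    rim-separates rim rb = one-side-empty (λ j → ¬? (j ≟f v) ×-dec (f j ≟c _))
      λ i j (i≢v , fi≡x) (j≢v , fj≡y) → rim-excludes rim i≢v j≢v fi≡x fj≡y rb

    classify-c₁ : f v ≡ c₁ → Rim f → (Y₁ ∪ Y₂) f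
    classify-c₁ fv≡c₁ rim with rim-separates rim (≢-sym c₂≢c₃ , ≢-sym c₁≢c₂ , ≢-sym c₁≢c₃)
    ... | inj₁ no-c₃ = inj₁ (fv≡c₁ , λ i i≢v fi≡c₃ → no-c₃ i (i≢v , fi≡c₃))
    ... | inj₂ no-c₁ with C? f
    ...   | yes (_ , rest-c₂) = inj₁ (fv≡c₁ , λ i i≢v → ≡⇒≢ c₂≢c₃ (rest-c₂ i i≢v))
    ...   | no ¬c = inj₂ ((fv≡c₁ , λ i i≢v fi≡c₁ → no-c₁ i (i≢v , fi≡c₁)) , ¬c)

    classify-c₂ : f v ≡ c₂ → Spokes f → Y₃ f
    classify-c₂ fv≡c₂ spokes = fv≡c₂ , λ i i≢v fi≡c₃ →
      spokes-exclude spokes i≢v fv≡c₂ fi≡c₃ (≢-sym c₁≢c₂ , c₁≢c₃ , c₂≢c₃)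

    classify-c₃ : f v ≡ c₃ → Spokes f → Rim f → (Y₄ ∪ Y₅) f
    classify-c₃ fv≡c₃ spokes rim = Sum.map only-c₁ only-c₃ (rim-separates rim rb₃₂₁)
      where
      rb₃₂₁ : Rainbow c₃ c₂ c₁
      rb₃₂₁ = ≢-sym c₂≢c₃ , ≢-sym c₁≢c₂ , ≢-sym c₁≢c₃
      not-c₂ : ∀ {i} → i ≢ v → f i ≢ c₂
      not-c₂ i≢v fi≡c₂ = spokes-exclude spokes i≢v fv≡c₃ fi≡c₂ (≢-sym c₁≢c₃ , c₁≢c₂ , ≢-sym c₂≢c₃)
      only-c₁ : (∀ i → ¬ Coloured c₃ i) → Y₄ f
      only-c₁ no-c₃ = fv≡c₃ , λ i i≢v → rainbow-last rb₃₂₁ (no-c₃ i ∘ (i≢v ,_)) (not-c₂ i≢v)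
      only-c₃ : (∀ i → ¬ Coloured c₁ i) → Y₅ f
      only-c₃ no-c₁ = fv≡c₃ , λ i i≢v →
        rainbow-last (rainbow-third c₁≢c₂) (no-c₁ i ∘ (i≢v ,_)) (not-c₂ i≢v)

  classify : Spokes ∩ Rim ⊆ Classes
  classify {f} (spokes , rim) with colour-cases c₁≢c₂ (f v)
  ... | inj₁ fv≡c₁ = Sum.map₂ inj₁ (classify-c₁ fv≡c₁ rim)
  ... | inj₂ (inj₁ fv≡c₂) = inj₂ (inj₂ (inj₁ (classify-c₂ fv≡c₂ spokes)))
  ... | inj₂ (inj₂ fv≡c₃) = inj₂ (inj₂ (inj₂ (classify-c₃ fv≡c₃ spokes rim)))

  classes-admissible : Classes ⊆ Spokes ∩ Rim
  classes-admissible (inj₁ (fv≡c₁ , not-c₃)) =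
    (λ _ _ → ¬rainbowˡ fv≡c₁)
    , λ i j i≢v j≢v → missing⇒¬rainbow (not-c₃ i i≢v) c₂≢c₃ (not-c₃ j j≢v)
  classes-admissible (inj₂ (inj₁ ((fv≡c₁ , not-c₁) , _))) =
    (λ _ _ → ¬rainbowˡ fv≡c₁)
    , λ i j i≢v j≢v → missing⇒¬rainbow (not-c₁ i i≢v) (≢-sym c₁≢c₂) (not-c₁ j j≢v)
  classes-admissible (inj₂ (inj₂ (inj₁ (fv≡c₂ , not-c₃)))) =
    (λ i i≢v → missing⇒¬rainbow (≡⇒≢ c₂≢c₃ fv≡c₂) c₁≢c₃ (not-c₃ i i≢v))
    , λ i j i≢v j≢v → missing⇒¬rainbow (not-c₃ i i≢v) c₂≢c₃ (not-c₃ j j≢v)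
  classes-admissible (inj₂ (inj₂ (inj₂ (inj₁ (_ , all-c₁))))) =
    (λ i i≢v → ¬rainbowʳ (all-c₁ i i≢v))
    , λ i j i≢v j≢v → ¬rainbow-ends (trans (all-c₁ i i≢v) (sym (all-c₁ j j≢v)))
  classes-admissible (inj₂ (inj₂ (inj₂ (inj₂ (fv≡c₃ , all-c₃))))) =
    (λ i i≢v → ¬rainbow-ends (trans fv≡c₃ (sym (all-c₃ i i≢v))))
    , λ i j i≢v j≢v → ¬rainbow-ends (trans (all-c₃ i i≢v) (sym (all-c₃ j j≢v)))

  Y₁⊥ : Y₁ ⊥ (Y₂ ∪ (Y₃ ∪ (Y₄ ∪ Y₅)))
  Y₁⊥ ((_ , not-c₃) , inj₁ ((fv≡c₁ , not-c₁) , ¬c)) =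
    ¬c (fv≡c₁ , λ i i≢v → rainbow-last (c₁≢c₃ , ≢-sym c₂≢c₃ , c₁≢c₂) (not-c₁ i i≢v) (not-c₃ i i≢v))
  Y₁⊥ ((fv≡c₁ , _) , inj₂ (inj₁ (fv≡c₂ , _)))          = c₁≢c₂ (trans (sym fv≡c₁) fv≡c₂)
  Y₁⊥ ((fv≡c₁ , _) , inj₂ (inj₂ (inj₁ (fv≡c₃ , _))))   = c₁≢c₃ (trans (sym fv≡c₁) fv≡c₃)
  Y₁⊥ ((fv≡c₁ , _) , inj₂ (inj₂ (inj₂ (fv≡c₃ , _))))   = c₁≢c₃ (trans (sym fv≡c₁) fv≡c₃)

  Y₂⊥ : Y₂ ⊥ (Y₃ ∪ (Y₄ ∪ Y₅))
  Y₂⊥ (((fv≡c₁ , _) , _) , inj₁ (fv≡c₂ , _))          = c₁≢c₂ (trans (sym fv≡c₁) fv≡c₂)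
  Y₂⊥ (((fv≡c₁ , _) , _) , inj₂ (inj₁ (fv≡c₃ , _)))   = c₁≢c₃ (trans (sym fv≡c₁) fv≡c₃)
  Y₂⊥ (((fv≡c₁ , _) , _) , inj₂ (inj₂ (fv≡c₃ , _)))   = c₁≢c₃ (trans (sym fv≡c₁) fv≡c₃)

  Y₃⊥ : Y₃ ⊥ (Y₄ ∪ Y₅)
  Y₃⊥ ((fv≡c₂ , _) , inj₁ (fv≡c₃ , _)) = c₂≢c₃ (trans (sym fv≡c₂) fv≡c₃)
  Y₃⊥ ((fv≡c₂ , _) , inj₂ (fv≡c₃ , _)) = c₂≢c₃ (trans (sym fv≡c₂) fv≡c₃)

  Y₄⊥Y₅ : Y₄ ⊥ Y₅
  Y₄⊥Y₅ ((_ , all-c₁) , (_ , all-c₃)) = c₁≢c₃ (trans (sym (all-c₁ o o≢v)) (all-c₃ o o≢v))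
    where
    o : Fin (2 + m)
    o = punchIn v zero
    o≢v : o ≢ v
    o≢v = punchInᵢ≢i v zero

  L : List (Fin (2 + m) → Colour)
  L = allFns (2 + m)

  count-classes : count Classes? L ≡ count Y₁? L + (count Y₂? L + (count Y₃? L + (count Y₄? L + count Y₅? L)))
  count-classes =
    trans (count-⊎ Y₁? _ Y₁⊥ L) (cong (count Y₁? L +_)
    (trans (count-⊎ Y₂? _ Y₂⊥ L) (cong (count Y₂? L +_)
    (trans (count-⊎ Y₃? _ Y₃⊥ L) (cong (count Y₃? L +_)
    (count-⊎ Y₄? Y₅? Y₄⊥Y₅ L))))))

  admissible≐classes : Admissible φ ≐ Classes
  admissible≐classes = ≐-trans admissible≐spokes∩rim (classify , classes-admissible)

  w-vertexSpecial : w φ ≡ 3 * 2 ^ suc m + 1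
  w-vertexSpecial = begin
    w φ               ≡⟨ w-via-admissible φ-gallai Classes? admissible≐classes ⟩
    count Classes? L  ≡⟨ count-classes ⟩
    count Y₁? L + (count Y₂? L + (count Y₃? L + (count Y₄? L + count Y₅? L)))
      ≡⟨ cong₂ (λ y₁ y₃₄₅ → y₁ + (count Y₂? L + y₃₄₅)) (count-onePoint-≢ v c₁ c₃) Y₃₄₅-size ⟩
    2 ^ suc m + (count Y₂? L + (2 ^ suc m + (1 + 1)))
      ≡⟨ class-sizes (2 ^ suc m) (count Y₂? L) Y₂-size ⟩
    3 * 2 ^ suc m + 1 ∎
    where
    open ≡-Reasoning
    Y₃₄₅-size : count Y₃? L + (count Y₄? L + count Y₅? L) ≡ 2 ^ suc m + (1 + 1)
    Y₃₄₅-size = cong₂ _+_ (count-onePoint-≢ v c₂ c₃) (cong₂ _+_ (count-onePoint-≡ v c₃ c₁) (count-onePoint-≡ v c₃ c₃))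
    C⊆B : C ⊆ B
    C⊆B (fv≡c₁ , all-c₂) = fv≡c₁ , λ i i≢v → ≡⇒≢ (≢-sym c₁≢c₂) (all-c₂ i i≢v)
    Y₂-size : count Y₂? L + 1 ≡ 2 ^ suc m
    Y₂-size = begin
      count Y₂? L + 1           ≡⟨ cong (count Y₂? L +_) (sym (count-onePoint-≡ v c₁ c₂)) ⟩
      count Y₂? L + count C? L  ≡⟨ sym (count-⊆ B? C? C⊆B L) ⟩
      count B? L                ≡⟨ count-onePoint-≢ v c₁ c₁ ⟩
      2 ^ suc m                 ∎

module EdgeSpecialCount {m} (φ : Colouring (2 + m)) (φ-sym : Symmetric φ) {p q : Fin (2 + m)} (p≢q : p ≢ q)
  {a : Colour} (b≢a : φ p q ≢ a)
  (off-pq : ∀ i j → i ≢ j → ¬ ((i ≡ p × j ≡ q) ⊎ (i ≡ q × j ≡ p)) → φ i j ≡ a) where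

  b c : Colour
  b = φ p q
  c = third a b

  a≢b : a ≢ b
  a≢b = ≢-sym b≢a

  b≢c : b ≢ c
  b≢c = proj₁ (proj₂ (rainbow-third a≢b))

  a≢c : a ≢ c
  a≢c = proj₂ (proj₂ (rainbow-third a≢b))

  IsPQ : Fin (2 + m) → Fin (2 + m) → Set
  IsPQ i j = (i ≡ p × j ≡ q) ⊎ (i ≡ q × j ≡ p)

  Outside : Fin (2 + m) → Set
  Outside i = i ≢ p × i ≢ q

  φ-cases : ∀ i j → i ≢ j → (IsPQ i j × φ i j ≡ b) ⊎ (¬ IsPQ i j × φ i j ≡ a)
  φ-cases i j i≢j with ((i ≟f p) ×-dec (j ≟f q)) ⊎-dec ((i ≟f q) ×-dec (j ≟f p))
  ... | yes (inj₁ (refl , refl)) = inj₁ (inj₁ (refl , refl) , refl)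
  ... | yes (inj₂ (refl , refl)) = inj₁ (inj₂ (refl , refl) , φ-sym q p)
  ... | no ¬pq                   = inj₂ (¬pq , off-pq i j i≢j ¬pq)

  outside⇒¬IsPQ : ∀ {i j} → Outside i → ¬ IsPQ i j
  outside⇒¬IsPQ (i≢p , _) (inj₁ (i≡p , _)) = i≢p i≡p
  outside⇒¬IsPQ (_ , i≢q) (inj₂ (i≡q , _)) = i≢q i≡q

  ¬IsPQ⇒outside : ∀ {i j} → ¬ IsPQ i j → i ≡ j ⊎ Outside i ⊎ Outside j
  ¬IsPQ⇒outside {i} {j} ¬pq with i ≟f p | i ≟f q | j ≟f p | j ≟f q
  ... | no i≢p  | no i≢q  | _       | _       = inj₂ (inj₁ (i≢p , i≢q))
  ... | _       | _       | no j≢p  | no j≢q  = inj₂ (inj₂ (j≢p , j≢q))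
  ... | yes i≡p | _       | yes j≡p | _       = inj₁ (trans i≡p (sym j≡p))
  ... | yes i≡p | _       | _       | yes j≡q = ⊥-elim (¬pq (inj₁ (i≡p , j≡q)))
  ... | _       | yes i≡q | yes j≡p | _       = ⊥-elim (¬pq (inj₂ (i≡q , j≡p)))
  ... | _       | yes i≡q | _       | yes j≡q = inj₁ (trans i≡q (sym j≡q))

  φ-gallai : Gallai φ
  φ-gallai = missing⇒gallai φ≢c
    where
    φ≢c : ∀ i j → i ≢ j → φ i j ≢ c
    φ≢c i j i≢j with φ-cases i j i≢j
    ... | inj₁ (_ , φ≡b) = ≡⇒≢ b≢c φ≡b
    ... | inj₂ (_ , φ≡a) = ≡⇒≢ a≢c φ≡a

  AtPQ OffPQ : Pred (Fin (2 + m) → Colour) 0ℓ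
  AtPQ f = ¬ Rainbow (f p) b (f q)
  OffPQ f = ∀ i j → ¬ IsPQ i j → ¬ Rainbow (f i) a (f j)

  admissible≐atPQ∩offPQ : Admissible φ ≐ AtPQ ∩ OffPQ
  admissible≐atPQ∩offPQ = to , from
    where
    to : Admissible φ ⊆ AtPQ ∩ OffPQ
    to {f} adm = adm p q p≢q , λ i j ¬pq → offPQ i j ¬pq (i ≟f j)
      where
      offPQ : ∀ i j → ¬ IsPQ i j → Dec (i ≡ j) → ¬ Rainbow (f i) a (f j)
      offPQ i j _   (yes i≡j) = ¬rainbow-ends (cong f i≡j)
      offPQ i j ¬pq (no i≢j)  = ¬rainbow-cong (off-pq i j i≢j ¬pq) (adm i j i≢j)
    from : AtPQ ∩ OffPQ ⊆ Admissible φ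
    from (atPQ , offPQ) i j i≢j with φ-cases i j i≢j
    ... | inj₁ (inj₁ (refl , refl) , _)     = atPQ
    ... | inj₁ (inj₂ (refl , refl) , φqp≡b) = ¬rainbow-cong (sym φqp≡b) (atPQ ∘ rainbow-swap)
    ... | inj₂ (¬pq , φ≡a)                  = ¬rainbow-cong (sym φ≡a) (offPQ i j ¬pq)

  X₁ B A X₂ X₃ X₄ X₅ : Pred (Fin (2 + m) → Colour) 0ℓ
  X₁ = Box (λ _ → _≢ c)
  B  = TwoPoint p q (_≡ a) (_≡ a) (_≢ b)
  A  = Box (λ _ → _≡ a)
  X₂ = B ∩ ∁ A
  X₃ = TwoPoint p q (_≡ c) (_≡ c) (_≢ b)
  X₄ = TwoPoint p q (_≡ b) (_≡ c) (_≡ a)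
  X₅ = TwoPoint p q (_≡ c) (_≡ b) (_≡ a)

  X₁? : Decidable X₁
  X₁? = box? λ _ → ∁? (_≟c c)
  B? : Decidable B
  B? = twoPoint? p q (_≟c a) (_≟c a) (∁? (_≟c b))
  A? : Decidable A
  A? = box? λ _ → _≟c a
  X₂? : Decidable X₂
  X₂? = B? ∩? ∁? A?
  X₃? : Decidable X₃
  X₃? = twoPoint? p q (_≟c c) (_≟c c) (∁? (_≟c b))
  X₄? : Decidable X₄
  X₄? = twoPoint? p q (_≟c b) (_≟c c) (_≟c a)
  X₅? : Decidable X₅
  X₅? = twoPoint? p q (_≟c c) (_≟c b) (_≟c a)

  Classes : Pred (Fin (2 + m) → Colour) 0ℓ
  Classes = X₁ ∪ (X₂ ∪ (X₃ ∪ (X₄ ∪ X₅)))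

  Classes? : Decidable Classes
  Classes? = X₁? ∪? (X₂? ∪? (X₃? ∪? (X₄? ∪? X₅?)))

  B⇒no-b : ∀ {f} → B f → ∀ i → f i ≢ b
  B⇒no-b = twoPoint⇒box {A = _≡ a} {_≡ a} {_≢ b} (≡⇒≢ a≢b) (≡⇒≢ a≢b) id

  X₃⇒no-b : ∀ {f} → X₃ f → ∀ i → f i ≢ b
  X₃⇒no-b = twoPoint⇒box {A = _≡ c} {_≡ c} {_≢ b} (≡⇒≢ (≢-sym b≢c)) (≡⇒≢ (≢-sym b≢c)) id

  module _ {f : Fin (2 + m) → Colour} where

    offPQ-excludes : OffPQ f → ∀ i j {x y} → ¬ IsPQ i j → f i ≡ x → f j ≡ y → ¬ Rainbow x a y
    offPQ-excludes offPQ i j ¬pq refl refl = offPQ i j ¬pq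

    forced-a : OffPQ f → ∀ {s r} → f s ≡ b → f r ≡ c → ∀ i → i ≢ p → i ≢ q → f i ≡ a
    forced-a offPQ {s} {r} fs≡b fr≡c i i≢p i≢q = ¬rainbow-twice⇒≡
      (offPQ-excludes offPQ i s (outside⇒¬IsPQ (i≢p , i≢q)) refl fs≡b)
      (offPQ-excludes offPQ i r (outside⇒¬IsPQ (i≢p , i≢q)) refl fr≡c)
      b≢a (≢-sym a≢c) b≢c

    classify-without-b : f p ≡ f q → (∀ i → f i ≢ b) → ∀ {r} → f r ≡ c → (X₂ ∪ X₃) f
    classify-without-b fp≡fq no-b {r} fr≡c with colour-cases a≢b (f p)
    ... | inj₁ fp≡a        =
      inj₁ ((fp≡a , trans (sym fp≡fq) fp≡a , λ i _ _ → no-b i) , λ all-a → a≢c (trans (sym (all-a r)) fr≡c))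
    ... | inj₂ (inj₁ fp≡b) = ⊥-elim (no-b p fp≡b)
    ... | inj₂ (inj₂ fp≡c) = inj₂ (fp≡c , trans (sym fp≡fq) fp≡c , λ i _ _ → no-b i)

    classify-with-b : OffPQ f → ∀ {s r} → f s ≡ b → f r ≡ c → (X₄ ∪ X₅) f
    classify-with-b offPQ {s} {r} fs≡b fr≡c with ((s ≟f p) ×-dec (r ≟f q)) ⊎-dec ((s ≟f q) ×-dec (r ≟f p))
    ... | yes (inj₁ (refl , refl)) = inj₁ (fs≡b , fr≡c , forced-a offPQ fs≡b fr≡c)
    ... | yes (inj₂ (refl , refl)) = inj₂ (fr≡c , fs≡b , forced-a offPQ fs≡b fr≡c)
    ... | no ¬pq = ⊥-elim (offPQ-excludes offPQ s r ¬pq fs≡b fr≡c (b≢a , a≢c , b≢c))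

  classify : AtPQ ∩ OffPQ ⊆ Classes
  classify {f} (atPQ , offPQ) with any? (λ r → f r ≟c c)
  ... | no no-c = inj₁ λ i fi≡c → no-c (i , fi≡c)
  ... | yes (r , fr≡c) with any? (λ s → f s ≟c b)
  ...   | no no-b = inj₂ (Sum.map₂ inj₁ (classify-without-b (¬rainbow⇒≡ atPQ (no-b′ p) (no-b′ q)) no-b′ fr≡c))
      where
      no-b′ : ∀ i → f i ≢ b
      no-b′ i fi≡b = no-b (i , fi≡b)
  ...   | yes (s , fs≡b) = inj₂ (inj₂ (inj₂ (classify-with-b offPQ fs≡b fr≡c)))

  module _ {f : Fin (2 + m) → Colour} where

    equal-ends-admissible : f p ≡ f q → (∀ i → f i ≢ b) → (AtPQ ∩ OffPQ) f
    equal-ends-admissible fp≡fq no-b = ¬rainbow-ends fp≡fq , λ i j _ → missing⇒¬rainbow (no-b i) a≢b (no-b j)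

    offPQ-from-outside : (∀ i → i ≢ p → i ≢ q → f i ≡ a) → OffPQ f
    offPQ-from-outside outside-a i j ¬pq with ¬IsPQ⇒outside ¬pq
    ... | inj₁ i≡j                = ¬rainbow-ends (cong f i≡j)
    ... | inj₂ (inj₁ (i≢p , i≢q)) = ¬rainbowˡ (outside-a i i≢p i≢q)
    ... | inj₂ (inj₂ (j≢p , j≢q)) = ¬rainbowʳ (outside-a j j≢p j≢q)

  classes-admissible : Classes ⊆ AtPQ ∩ OffPQ
  classes-admissible (inj₁ no-c) =
    missing⇒¬rainbow (no-c p) b≢c (no-c q) , λ i j _ → missing⇒¬rainbow (no-c i) a≢c (no-c j)
  classes-admissible (inj₂ (inj₁ (bb@(fp≡a , fq≡a , _) , _))) =
    equal-ends-admissible (trans fp≡a (sym fq≡a)) (B⇒no-b bb)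
  classes-admissible (inj₂ (inj₂ (inj₁ x₃@(fp≡c , fq≡c , _)))) =
    equal-ends-admissible (trans fp≡c (sym fq≡c)) (X₃⇒no-b x₃)
  classes-admissible (inj₂ (inj₂ (inj₂ (inj₁ (fp≡b , _ , outside-a))))) =
    ¬rainbowˡ fp≡b , offPQ-from-outside outside-a
  classes-admissible (inj₂ (inj₂ (inj₂ (inj₂ (_ , fq≡b , outside-a))))) =
    ¬rainbowʳ fq≡b , offPQ-from-outside outside-a

  X₁⊥ : X₁ ⊥ (X₂ ∪ (X₃ ∪ (X₄ ∪ X₅)))
  X₁⊥ (no-c , inj₁ (bb , ¬all-a)) =
    ¬all-a λ i → rainbow-last (b≢c , ≢-sym a≢c , ≢-sym a≢b) (B⇒no-b bb i) (no-c i)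
  X₁⊥ (no-c , inj₂ (inj₁ (fp≡c , _)))                = no-c p fp≡c
  X₁⊥ (no-c , inj₂ (inj₂ (inj₁ (_ , fq≡c , _))))     = no-c q fq≡c
  X₁⊥ (no-c , inj₂ (inj₂ (inj₂ (fp≡c , _))))         = no-c p fp≡c

  X₂⊥ : X₂ ⊥ (X₃ ∪ (X₄ ∪ X₅))
  X₂⊥ (((fp≡a , _) , _) , inj₁ (fp≡c , _))          = a≢c (trans (sym fp≡a) fp≡c)
  X₂⊥ (((fp≡a , _) , _) , inj₂ (inj₁ (fp≡b , _)))   = a≢b (trans (sym fp≡a) fp≡b)
  X₂⊥ (((fp≡a , _) , _) , inj₂ (inj₂ (fp≡c , _)))   = a≢c (trans (sym fp≡a) fp≡c)

  X₃⊥ : X₃ ⊥ (X₄ ∪ X₅)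
  X₃⊥ ((fp≡c , _) , inj₁ (fp≡b , _))          = b≢c (trans (sym fp≡b) fp≡c)
  X₃⊥ ((_ , fq≡c , _) , inj₂ (_ , fq≡b , _))  = b≢c (trans (sym fq≡b) fq≡c)

  X₄⊥X₅ : X₄ ⊥ X₅
  X₄⊥X₅ ((fp≡b , _) , (fp≡c , _)) = b≢c (trans (sym fp≡b) fp≡c)

  L : List (Fin (2 + m) → Colour)
  L = allFns (2 + m)

  count-classes : count Classes? L ≡ count X₁? L + (count X₂? L + (count X₃? L + (count X₄? L + count X₅? L)))
  count-classes =
    trans (count-⊎ X₁? _ X₁⊥ L) (cong (count X₁? L +_)
    (trans (count-⊎ X₂? _ X₂⊥ L) (cong (count X₂? L +_)
    (trans (count-⊎ X₃? _ X₃⊥ L) (cong (count X₃? L +_)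
    (count-⊎ X₄? X₅? X₄⊥X₅ L))))))

  admissible≐classes : Admissible φ ≐ Classes
  admissible≐classes = ≐-trans admissible≐atPQ∩offPQ (classify , classes-admissible)

  w-edgeSpecial : w φ ≡ 3 * 2 ^ suc m + 1
  w-edgeSpecial = begin
    w φ               ≡⟨ w-via-admissible φ-gallai Classes? admissible≐classes ⟩
    count Classes? L  ≡⟨ count-classes ⟩
    count X₁? L + (count X₂? L + (count X₃? L + (count X₄? L + count X₅? L)))
      ≡⟨ cong₂ (λ x₁ x₃₄₅ → x₁ + (count X₂? L + x₃₄₅)) X₁-size X₃₄₅-size ⟩
    2 ^ (2 + m) + (count X₂? L + (2 ^ m + (1 + 1)))
      ≡⟨ class-sizes (2 ^ (2 + m)) (count X₂? L) X₂-size ⟩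
    2 ^ (2 + m) + 2 * 2 ^ m + 1
      ≡⟨ cong (_+ 1) (+-comm (2 ^ (2 + m)) (2 ^ suc m)) ⟩
    3 * 2 ^ suc m + 1 ∎
    where
    open ≡-Reasoning
    X₁-size : count X₁? L ≡ 2 ^ (2 + m)
    X₁-size = trans (count-uniform (2 + m) (∁? (_≟c c))) (cong (_^ (2 + m)) (size-≢ c))
    X₃₄₅-size : count X₃? L + (count X₄? L + count X₅? L) ≡ 2 ^ m + (1 + 1)
    X₃₄₅-size = cong₂ _+_ (count-twoPoint-≢ p≢q c c b)
                          (cong₂ _+_ (count-twoPoint-≡ p≢q b c a) (count-twoPoint-≡ p≢q c b a))
    A-size : count A? L ≡ 1
    A-size = trans (count-uniform (2 + m) (_≟c a)) (trans (cong (_^ (2 + m)) (size-≡ a)) (^-zeroˡ (2 + m)))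
    A⊆B : A ⊆ B
    A⊆B all-a = all-a p , all-a q , λ i _ _ → ≡⇒≢ a≢b (all-a i)
    X₂-size : count X₂? L + 1 ≡ 2 ^ m
    X₂-size = begin
      count X₂? L + 1           ≡⟨ cong (count X₂? L +_) (sym A-size) ⟩
      count X₂? L + count A? L  ≡⟨ sym (count-⊆ B? A? A⊆B L) ⟩
      count B? L                ≡⟨ count-twoPoint-≢ p≢q a a b ⟩
      2 ^ m                     ∎

-- ExactlyTwoColours φ already follows from either form of specialness.
lemma2p3 : (n : ℕ) → n ≥ 3 → (φ : Colouring n) → Symmetric φ →
    ExactlyTwoColours φ → (VertexSpecial φ ⊎ EdgeSpecial φ) →
    w φ ≡ 3 * 2 ^ (n ∸ 1) + 1
lemma2p3 (suc (suc m)) (s≤s (s≤s _)) φ φ-sym _ (inj₁ (v , _ , _ , c₁≢c₂ , at-v , off-v)) =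
  VertexSpecialCount.w-vertexSpecial φ φ-sym v c₁≢c₂ at-v off-v
lemma2p3 (suc (suc m)) (s≤s (s≤s _)) φ φ-sym _ (inj₂ (_ , _ , _ , p≢q , b≢a , off-pq)) =
  EdgeSpecialCount.w-edgeSpecial φ φ-sym p≢q b≢a off-pq
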